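{- Let $n \ge 3$. The sequence $\{1, F(1), F(2), \ldots, F(n-1)\}$ (the Fibonacci sequence shifted one place right) is a minimizing $(n-3)$-ordered sequence of size $n$ for the elongated binary tree in the class $M_{n,n-3}$; that is, it belongs to $M_{n,n-3}$ and its Huffman cost is at most that of every sequence in $M_{n,n-3}$.
   Context: $F(i)$ denotes the $i$-th Fibonacci number: $F(0)=0$, $F(1)=1$, $F(i)=F(i-1)+F(i-2)$ for $i>1$. A (strictly) binary tree is an ordered rooted tree in which every non-leaf node has exactly two children; its size is its number of leaves. A binary tree is elongated if among any two sibling nodes at least one is a leaf. For a binary tree $T$ with positive weights $p_1,\dots,p_n$ at its leaves, the weighted external path length is $E(T,P)=\sum_{i=1}^n l_i p_i$, where $l_i$ is the length of the path from the root to leaf $i$. Huffman algorithm on a non-decreasing sequence $P=\{p_1,\dots,p_n\}$ of positive integers: set $P^{(0)}=P$; for $i=1,\dots,n-1$, $P^{(i)}=\{p^{(i)}_1,\dots,p^{(i)}_{n-i}\}$ is obtained from $P^{(i-1)}$ by replacing its two smallest entries $p^{(i-1)}_1,p^{(i-1)}_2$ by their sum and sorting non-decreasingly; the merges define a Huffman tree of $P$, which minimizes $E(T,P)$ over binary trees with leaf weights $P$ (the Huffman cost). A non-decreasing sequence $P$ of $n$ positive integers is $k$-ordered if $p^{(i)}_2 = p^{(i)}_3$ for $i=0,\dots,k$ and $p^{(i)}_2 < p^{(i)}_3$ for $i=k+1,\dots,n-3$. $M_{n,k}$ denotes the set of all $k$-ordered sequences of size $n$ for which an elongated binary tree of size $n$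 is a Huffman tree. A sequence $P_{\min}\in M$ is minimizing for the tree $T$ in a class $M$ if $E(T,P_{\min})\le E(T,P)$ for all $P\in M$. -}

module Defs where

open import Data.Nat using (ℕ; zero; suc; _+_; _*_; _∸_; _≤_; _<_; _≤ᵇ_)
open import Data.Bool using (if_then_else_)
open import Data.List using (List; []; _∷_; map; length; upTo)
open import Data.List.Relation.Unary.All using (All)
open import Data.List.Relation.Unary.Linked using (Linked)
open import Data.List.Relation.Binary.Permutation.Propositional using (_↭_)
open import Data.Product using (Σ; ∃; _×_; _,_)
open import Data.Sum using (_⊎_)
open import Data.Unit using (⊤)
open import Data.Empty using (⊥)
open import Relation.Binary.PropositionalEquality using (_≡_)

F : ℕ → ℕ
F zero = 0
F (suc zero) = 1
F (suc (suc i)) = F (suc i) + F i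

fibSeq : ℕ → List ℕ
fibSeq zero = []
fibSeq (suc m) = 1 ∷ map (λ i → F (suc i)) (upTo m)

insert : ℕ → List ℕ → List ℕ
insert x [] = x ∷ []
insert x (y ∷ ys) = if x ≤ᵇ y then x ∷ y ∷ ys else y ∷ insert x ys

huffStep : List ℕ → List ℕ
huffStep (x ∷ y ∷ rest) = insert (x + y) rest
huffStep xs = xs

huffSeq : ℕ → List ℕ → List ℕ
huffSeq zero P = P
huffSeq (suc i) P = huffStep (huffSeq i P)

-- p^(i)_2 = p^(i)_3  (entries 2 and 3, 1-indexed)
SecondEqThird : List ℕ → Set
SecondEqThird xs = Σ ℕ λ a → Σ ℕ λ b → Σ ℕ λ c → Σ (List ℕ) λ rest →
  (xs ≡ a ∷ b ∷ c ∷ rest) × (b ≡ c)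

SecondLtThird : List ℕ → Set
SecondLtThird xs = Σ ℕ λ a → Σ ℕ λ b → Σ ℕ λ c → Σ (List ℕ) λ rest →
  (xs ≡ a ∷ b ∷ c ∷ rest) × (b < c)

ValidSeq : ℕ → List ℕ → Set
ValidSeq n P = (length P ≡ n) × Linked _≤_ P × All (λ p → 0 < p) P

KOrdered : ℕ → ℕ → List ℕ → Set
KOrdered n k P = ValidSeq n P
  × (∀ i → i ≤ k → SecondEqThird (huffSeq i P))
  × (∀ i → k < i → i ≤ n ∸ 3 → SecondLtThird (huffSeq i P))

data Tree : Set where
  leaf : ℕ → Tree
  node : Tree → Tree → Tree

weight : Tree → ℕ
weight (leaf p) = p
weight (node l r) = weight l + weight r

IsLeaf : Tree → Set
IsLeaf (leaf _) = ⊤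
IsLeaf (node _ _) = ⊥

Elongated : Tree → Set
Elongated (leaf _) = ⊤
Elongated (node l r) = (IsLeaf l ⊎ IsLeaf r) × Elongated l × Elongated r

pathLenAt : ℕ → Tree → ℕ
pathLenAt d (leaf p) = d * p
pathLenAt d (node l r) = pathLenAt (suc d) l + pathLenAt (suc d) r

E : Tree → ℕ
E = pathLenAt 0

-- A run of the Huffman algorithm on a forest: repeatedly merge two trees
-- of smallest weight (any tie-breaking, either child order) until one tree remains.
data HuffRun : List Tree → Tree → Set where
  done : ∀ {t} → HuffRun (t ∷ []) t
  step : ∀ {F x y rest t} → F ↭ (x ∷ y ∷ rest) →
         All (λ z → (weight x ≤ weight z) × (weight y ≤ weight z)) rest →
         HuffRun (node x y ∷ rest) t → HuffRun F t

HuffmanTree : List ℕ → Tree → Set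
HuffmanTree P T = HuffRun (map leaf P) T

M : ℕ → ℕ → List ℕ → Set
M n k P = KOrdered n k P × ∃ λ T → Elongated T × HuffmanTree P T

-- An elongated tree is a caterpillar: starting from a leaf, a new leaf is hung
-- beside the tree built so far, n - 1 times. In a Huffman tree the children of
-- every node weigh at most that node's sibling, so the leaf hung at step i weighs
-- at least both children of the tree it is hung beside; inductively it weighs at
-- least F i, and the i-th spine node weighs at least F (i + 2). Hence every
-- elongated Huffman tree of size n costs at least F 3 + ⋯ + F (n + 1). The shifted
-- Fibonacci sequence has total weight exactly F (n + 1), which makes all these
-- bounds tight, so its elongated Huffman trees attain that minimum.
module Submission where

open import Defs
open import Data.Nat using (ℕ; zero; suc; _+_; _*_; _∸_; _≤_; _<_; z≤n; s≤s; _≤ᵇ_)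
open import Data.Nat.Properties
open import Data.Nat.ListAction using (sum)
open import Data.Nat.ListAction.Properties using (sum-↭)
open import Algebra.Properties.CommutativeSemigroup +-commutativeSemigroup
  using (interchange)
open import Data.Bool using (true; false)
open import Data.List using (List; []; _∷_; map; length; applyUpTo)
open import Data.List.Relation.Unary.All as All using (All; []; _∷_)
open import Data.List.Relation.Unary.All.Properties as All using ()
open import Data.List.Relation.Unary.Linked using (Linked; [-]; _∷_)
open import Data.List.Relation.Binary.Permutation.Propositional as ↭ using (_↭_)
open import Data.List.Relation.Binary.Permutation.Propositional.Properties
  using (All-resp-↭; map⁺)
open import Data.Product using (∃; _×_; _,_; proj₁; proj₂)
open import Data.Sum using (inj₁; inj₂)
open import Data.Unit using (⊤; tt)
open import Data.Empty using (⊥-elim)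
open import Relation.Nullary.Reflects using (ofʸ; ofⁿ)
open import Relation.Binary.PropositionalEquality

F-mono : ∀ i → F i ≤ F (1 + i)
F-mono zero    = z≤n
F-mono (suc i) = m≤m+n (F (1 + i)) (F i)

F-pos : ∀ i → 0 < F (1 + i)
F-pos zero    = s≤s z≤n
F-pos (suc i) = ≤-trans (F-pos i) (m≤m+n _ _)

F-strict : ∀ i → F (2 + i) < F (3 + i)
F-strict i = subst (_≤ F (2 + i) + F (1 + i)) (+-comm (F (2 + i)) 1)
  (+-monoʳ-≤ (F (2 + i)) (F-pos i))

-- F 3 + ⋯ + F (i + 2), the weights of the i internal nodes of the Fibonacci caterpillar
fibCost : ℕ → ℕ
fibCost zero    = 0
fibCost (suc i) = fibCost i + F (3 + i)

size : Tree → ℕ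
size (leaf _)   = 1
size (node l r) = size l + size r

Positive : Tree → Set
Positive (leaf p)   = 0 < p
Positive (node l r) = Positive l × Positive r

ChildrenAtMost : Tree → ℕ → Set
ChildrenAtMost (leaf _)   b = ⊤
ChildrenAtMost (node l r) b = weight l ≤ b × weight r ≤ b

ChildrenAtMost-weaken : ∀ t {b c} → ChildrenAtMost t b → b ≤ c → ChildrenAtMost t c
ChildrenAtMost-weaken (leaf _)   _            _   = tt
ChildrenAtMost-weaken (node _ _) (l≤b , r≤b) b≤c = ≤-trans l≤b b≤c , ≤-trans r≤b b≤c

SiblingOrdered : Tree → Set
SiblingOrdered (leaf _)   = ⊤
SiblingOrdered (node l r) = SiblingOrdered l × SiblingOrdered r
                          × ChildrenAtMost l (weight r) × ChildrenAtMost r (weight l)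

pathLenAt-suc : ∀ d t → pathLenAt (suc d) t ≡ pathLenAt d t + weight t
pathLenAt-suc d (leaf p)   = +-comm p (d * p)
pathLenAt-suc d (node l r) = begin
  pathLenAt (suc (suc d)) l + pathLenAt (suc (suc d)) r
    ≡⟨ cong₂ _+_ (pathLenAt-suc (suc d) l) (pathLenAt-suc (suc d) r) ⟩
  (pathLenAt (suc d) l + weight l) + (pathLenAt (suc d) r + weight r)
    ≡⟨ interchange (pathLenAt (suc d) l) (weight l) (pathLenAt (suc d) r) (weight r) ⟩
  pathLenAt d (node l r) + weight (node l r) ∎
  where open ≡-Reasoning

E-node : ∀ l r → E (node l r) ≡ E l + E r + weight (node l r)
E-node l r = begin
  pathLenAt 1 l + pathLenAt 1 r        ≡⟨ cong₂ _+_ (pathLenAt-suc 0 l) (pathLenAt-suc 0 r) ⟩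
  (E l + weight l) + (E r + weight r)  ≡⟨ interchange (E l) (weight l) (E r) (weight r) ⟩
  E l + E r + weight (node l r)        ∎
  where open ≡-Reasoning

huffRun-additive : (f : Tree → ℕ) → (∀ l r → f (node l r) ≡ f l + f r) →
  ∀ {ts t} → HuffRun ts t → f t ≡ sum (map f ts)
huffRun-additive f f-node done = sym (+-identityʳ _)
huffRun-additive f f-node (step {ts} {x} {y} {rest} {t} ts↭ _ run) = begin
  f t                              ≡⟨ huffRun-additive f f-node run ⟩
  f (node x y) + sum (map f rest)  ≡⟨ cong (_+ sum (map f rest)) (f-node x y) ⟩
  f x + f y + sum (map f rest)     ≡⟨ +-assoc (f x) (f y) _ ⟩
  sum (map f (x ∷ y ∷ rest))       ≡⟨ sum-↭ (map⁺ f (↭.↭-sym ts↭)) ⟩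
  sum (map f ts)                   ∎
  where open ≡-Reasoning

huffRun-all : (P : Tree → Set) → (∀ {l r} → P l → P r → P (node l r)) →
  ∀ {ts t} → HuffRun ts t → All P ts → P t
huffRun-all P P-node done (pt ∷ []) = pt
huffRun-all P P-node (step ts↭ _ run) pts with All-resp-↭ ts↭ pts
... | px ∷ py ∷ prest = huffRun-all P P-node run (P-node px py ∷ prest)

Stratified : List Tree → Set
Stratified ts = All (λ t → All (λ u → ChildrenAtMost t (weight u)) ts) ts

stratified-resp-↭ : ∀ {ts us} → ts ↭ us → Stratified ts → Stratified us
stratified-resp-↭ ts↭ s = All-resp-↭ ts↭ (All.map (All-resp-↭ ts↭) s)

stratified-merge : ∀ {x y rest} →
  All (λ z → weight x ≤ weight z × weight y ≤ weight z) rest →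
  Stratified (x ∷ y ∷ rest) → Stratified (node x y ∷ rest)
stratified-merge {x} {y} {rest} xy≤rest (_ ∷ _ ∷ s-rest) =
  ((m≤m+n (weight x) (weight y) , m≤n+m (weight y) (weight x)) ∷ xy≤rest)
  ∷ All.map below-merged s-rest
  where
  below-merged : ∀ {z} → All (λ u → ChildrenAtMost z (weight u)) (x ∷ y ∷ rest) →
                 All (λ u → ChildrenAtMost z (weight u)) (node x y ∷ rest)
  below-merged {z} (z≤x ∷ _ ∷ z≤rest) =
    ChildrenAtMost-weaken z z≤x (m≤m+n (weight x) (weight y)) ∷ z≤rest

huffRun-siblingOrdered : ∀ {ts t} → HuffRun ts t →
  All SiblingOrdered ts → Stratified ts → SiblingOrdered t
huffRun-siblingOrdered done (o ∷ []) _ = o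
huffRun-siblingOrdered (step ts↭ xy≤rest run) os s
  with All-resp-↭ ts↭ os | stratified-resp-↭ ts↭ s
... | ox ∷ oy ∷ orest | s′@((_ ∷ x≤y ∷ _) ∷ (y≤x ∷ _) ∷ _) =
  huffRun-siblingOrdered run ((ox , oy , x≤y , y≤x) ∷ orest) (stratified-merge xy≤rest s′)

leaves-stratified : ∀ ps → Stratified (map leaf ps)
leaves-stratified ps =
  All.map⁺ (All.universal (λ _ → All.universal (λ _ → tt) (map leaf ps)) ps)

sum-size-leaves : ∀ ps → sum (map size (map leaf ps)) ≡ length ps
sum-size-leaves []       = refl
sum-size-leaves (_ ∷ ps) = cong suc (sum-size-leaves ps)

sum-weight-leaves : ∀ ps → sum (map weight (map leaf ps)) ≡ sum ps
sum-weight-leaves []       = refl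
sum-weight-leaves (p ∷ ps) = cong (p +_) (sum-weight-leaves ps)

data Hang (a : ℕ) (c : Tree) : Tree → Set where
  hangˡ : Hang a c (node (leaf a) c)
  hangʳ : Hang a c (node c (leaf a))

hang-size : ∀ {a c t} → Hang a c t → size t ≡ suc (size c)
hang-size         hangˡ = refl
hang-size {c = c} hangʳ = +-comm (size c) 1

hang-weight : ∀ {a c t} → Hang a c t → weight t ≡ a + weight c
hang-weight         hangˡ = refl
hang-weight {a} {c} hangʳ = +-comm (weight c) a

hang-E : ∀ {a c t} → Hang a c t → E t ≡ E c + weight t
hang-E {a} {c} hangˡ = E-node (leaf a) c
hang-E {a} {c} hangʳ =
  trans (E-node c (leaf a)) (cong (_+ (weight c + a)) (+-identityʳ (E c)))

data Spine : ℕ → Tree → Set where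
  tip  : ∀ {p} → 0 < p → Spine 0 (leaf p)
  grow : ∀ {i a c t} → Spine i c → F (1 + i) ≤ a → Hang a c t → Spine (suc i) t

spine-size : ∀ {i t} → Spine i t → size t ≡ suc i
spine-size (tip _)      = refl
spine-size (grow s _ h) = trans (hang-size h) (cong suc (spine-size s))

spine-weight : ∀ {i t} → Spine i t → F (2 + i) ≤ weight t
spine-weight (tip p>0) = p>0
spine-weight {suc i} {t} (grow {a = a} {c} s a≥ h) = begin
  F (3 + i)              ≡⟨ +-comm (F (2 + i)) (F (1 + i)) ⟩
  F (1 + i) + F (2 + i)  ≤⟨ +-mono-≤ a≥ (spine-weight s) ⟩
  a + weight c           ≡⟨ hang-weight h ⟨
  weight t               ∎
  where open ≤-Reasoning

spine-cost-lower : ∀ {i t} → Spine i t → fibCost i ≤ E t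
spine-cost-lower (tip _) = z≤n
spine-cost-lower {suc i} {t} s@(grow {c = c} sc _ h) = begin
  fibCost i + F (3 + i)  ≤⟨ +-mono-≤ (spine-cost-lower sc) (spine-weight s) ⟩
  E c + weight t         ≡⟨ hang-E h ⟨
  E t                    ∎
  where open ≤-Reasoning

spine-cost-tight : ∀ {i t} → Spine i t → weight t ≤ F (2 + i) → E t ≤ fibCost i
spine-cost-tight (tip _) _ = z≤n
spine-cost-tight {suc i} {t} (grow {a = a} {c} s a≥ h) t≤ = begin
  E t                    ≡⟨ hang-E h ⟩
  E c + weight t         ≤⟨ +-mono-≤ (spine-cost-tight s c≤) t≤ ⟩
  fibCost i + F (3 + i)  ∎
  where
  open ≤-Reasoning
  c≤ : weight c ≤ F (2 + i)
  c≤ = +-cancelˡ-≤ (F (1 + i)) _ _ (begin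
    F (1 + i) + weight c   ≤⟨ +-monoˡ-≤ (weight c) a≥ ⟩
    a + weight c           ≡⟨ hang-weight h ⟨
    weight t               ≤⟨ t≤ ⟩
    F (3 + i)              ≡⟨ +-comm (F (2 + i)) (F (1 + i)) ⟩
    F (1 + i) + F (2 + i)  ∎)

hung-leaf-bound : ∀ {i a c} → Spine i c → 0 < a → ChildrenAtMost c a → F (1 + i) ≤ a
hung-leaf-bound (tip _)          a>0 _         = a>0
hung-leaf-bound (grow s _ hangˡ) _   (_ , c≤a) = ≤-trans (spine-weight s) c≤a
hung-leaf-bound (grow s _ hangʳ) _   (c≤a , _) = ≤-trans (spine-weight s) c≤a

elongated-spine : ∀ t → Elongated t → SiblingOrdered t → Positive t → ∃ λ i → Spine i t
elongated-spine (leaf _) _ _ p>0 = 0 , tip p>0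
elongated-spine (node (leaf a) c) (_ , _ , ec) (_ , oc , _ , c≤a) (a>0 , pc)
  with elongated-spine c ec oc pc
... | i , s = suc i , grow s (hung-leaf-bound s a>0 c≤a) hangˡ
elongated-spine (node c@(node _ _) (leaf a)) (_ , ec , _) (oc , _ , c≤a , _) (pc , a>0)
  with elongated-spine c ec oc pc
... | i , s = suc i , grow s (hung-leaf-bound s a>0 c≤a) hangʳ
elongated-spine (node (node _ _) (node _ _)) (inj₁ () , _) _ _
elongated-spine (node (node _ _) (node _ _)) (inj₂ () , _) _ _

huffman-spine : ∀ {ps t i} → length ps ≡ suc i → All (0 <_) ps →
  Elongated t → HuffmanTree ps t → Spine i t
huffman-spine {ps} {t} {i} len pos et run = subst (λ j → Spine j t) j≡i (proj₂ spine)
  where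
  spine : ∃ λ j → Spine j t
  spine = elongated-spine t et
    (huffRun-siblingOrdered run (All.map⁺ (All.universal (λ _ → tt) ps)) (leaves-stratified ps))
    (huffRun-all Positive _,_ run (All.map⁺ pos))
  open ≡-Reasoning
  j≡i : proj₁ spine ≡ i
  j≡i = suc-injective (begin
    suc (proj₁ spine)             ≡⟨ spine-size (proj₂ spine) ⟨
    size t                        ≡⟨ huffRun-additive size (λ _ _ → refl) run ⟩
    sum (map size (map leaf ps))  ≡⟨ sum-size-leaves ps ⟩
    length ps                     ≡⟨ len ⟩
    suc i                         ∎)

fibsFrom : ℕ → ℕ → List ℕ
fibsFrom s zero    = []
fibsFrom s (suc k) = F s ∷ fibsFrom (suc s) k

map-F-applyUpTo : ∀ {g} s k → (∀ i → g i ≡ s + i) →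
  map (λ i → F (1 + i)) (applyUpTo g k) ≡ fibsFrom (suc s) k
map-F-applyUpTo s zero    _ = refl
map-F-applyUpTo s (suc k) g≗ =
  cong₂ _∷_ (cong (λ j → F (suc j)) (trans (g≗ 0) (+-identityʳ s)))
            (map-F-applyUpTo (suc s) k (λ i → trans (g≗ (suc i)) (+-suc s i)))

fibSeq-fibsFrom : ∀ k → fibSeq (suc k) ≡ 1 ∷ fibsFrom 1 k
fibSeq-fibsFrom k = cong (1 ∷_) (map-F-applyUpTo 0 k (λ _ → refl))

length-fibsFrom : ∀ s k → length (fibsFrom s k) ≡ k
length-fibsFrom s zero    = refl
length-fibsFrom s (suc k) = cong suc (length-fibsFrom (suc s) k)

sum-fibsFrom : ∀ s k → F (suc s) + sum (fibsFrom s k) ≡ F (suc (s + k))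
sum-fibsFrom s zero    = trans (+-identityʳ _) (cong (λ j → F (suc j)) (sym (+-identityʳ s)))
sum-fibsFrom s (suc k) = begin
  F (suc s) + (F s + sum (fibsFrom (suc s) k))  ≡⟨ +-assoc (F (suc s)) (F s) _ ⟨
  F (suc (suc s)) + sum (fibsFrom (suc s) k)    ≡⟨ sum-fibsFrom (suc s) k ⟩
  F (suc (suc s + k))                           ≡⟨ cong (λ j → F (suc j)) (+-suc s k) ⟨
  F (suc (s + suc k))                           ∎
  where open ≡-Reasoning

fibsFrom-lowerBound : ∀ {a} s k → a ≤ F s → All (a ≤_) (fibsFrom s k)
fibsFrom-lowerBound s zero    _   = []
fibsFrom-lowerBound s (suc k) a≤ = a≤ ∷ fibsFrom-lowerBound (suc s) k (≤-trans a≤ (F-mono s))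

fibsFrom-linked : ∀ {a} s k → a ≤ F s → Linked _≤_ (a ∷ fibsFrom s k)
fibsFrom-linked s zero    _   = [-]
fibsFrom-linked s (suc k) a≤ = a≤ ∷ fibsFrom-linked (suc s) k (F-mono s)

fibs-positive : ∀ k → All (0 <_) (1 ∷ fibsFrom 1 k)
fibs-positive k = s≤s z≤n ∷ fibsFrom-lowerBound 1 k (s≤s z≤n)

fibs-valid : ∀ k → ValidSeq (suc k) (1 ∷ fibsFrom 1 k)
fibs-valid k = cong suc (length-fibsFrom 1 k) , fibsFrom-linked 1 k (s≤s z≤n) , fibs-positive k

insert-beyond : ∀ {b x} rest → b < x → insert x (b ∷ x ∷ rest) ≡ b ∷ x ∷ x ∷ rest
insert-beyond {b} {x} rest b<x
  with x ≤ᵇ b | ≤ᵇ-reflects-≤ x b | x ≤ᵇ x | ≤ᵇ-reflects-≤ x x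
... | false | _       | true  | _       = refl
... | true  | ofʸ x≤b | _     | _       = ⊥-elim (<⇒≱ b<x x≤b)
... | false | _       | false | ofⁿ x≰x = ⊥-elim (x≰x ≤-refl)

fibWindow : ℕ → List ℕ → List ℕ
fibWindow i rest = F (1 + i) ∷ F (2 + i) ∷ F (2 + i) ∷ rest

huffStep-fibWindow : ∀ i rest →
  huffStep (fibWindow i (F (3 + i) ∷ rest)) ≡ fibWindow (1 + i) rest
huffStep-fibWindow i rest = trans
  (cong (λ w → insert w (F (2 + i) ∷ F (3 + i) ∷ rest)) (+-comm (F (1 + i)) (F (2 + i))))
  (insert-beyond rest (F-strict i))

huffSeq-fibs : ∀ m i → i ≤ m →
  huffSeq i (1 ∷ fibsFrom 1 (2 + m)) ≡ fibWindow i (fibsFrom (3 + i) (m ∸ i))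
huffSeq-fibs m zero    _   = refl
huffSeq-fibs m (suc i) i<m = begin
  huffStep (huffSeq i (1 ∷ fibsFrom 1 (2 + m)))
    ≡⟨ cong huffStep (huffSeq-fibs m i (<⇒≤ i<m)) ⟩
  huffStep (fibWindow i (fibsFrom (3 + i) (m ∸ i)))
    ≡⟨ cong (λ k → huffStep (fibWindow i (fibsFrom (3 + i) k))) (+-∸-assoc 1 i<m) ⟩
  huffStep (fibWindow i (fibsFrom (3 + i) (suc (m ∸ suc i))))
    ≡⟨ huffStep-fibWindow i _ ⟩
  fibWindow (1 + i) (fibsFrom (4 + i) (m ∸ suc i)) ∎
  where open ≡-Reasoning

caterpillar-run : ∀ s k {S} → weight S ≡ F (suc s) → Elongated S →
  ∃ λ T → Elongated T × HuffRun (S ∷ leaf (F s) ∷ map leaf (fibsFrom (suc s) k)) T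
caterpillar-run s zero    {S} _  eS =
  node S (leaf (F s)) , (inj₂ tt , eS , tt) , step ↭.refl [] done
caterpillar-run s (suc k) {S} wS eS
  with caterpillar-run (suc s) k {node S (leaf (F s))} (cong (_+ F s) wS) (inj₂ tt , eS , tt)
... | T , eT , run = T , eT , step ↭.refl (All.map⁺ (All.zip (S≤rest , Fs≤rest))) run
  where
  S≤rest  = fibsFrom-lowerBound (suc s) (suc k) (≤-reflexive wS)
  Fs≤rest = fibsFrom-lowerBound (suc s) (suc k) (F-mono s)

fibs-M : ∀ m → M (3 + m) m (1 ∷ fibsFrom 1 (2 + m))
fibs-M m = (fibs-valid (2 + m) , secondEqThird , λ i m<i i≤m → ⊥-elim (<⇒≱ m<i i≤m))
         , caterpillar-run 1 (1 + m) refl tt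
  where
  secondEqThird : ∀ i → i ≤ m → SecondEqThird (huffSeq i (1 ∷ fibsFrom 1 (2 + m)))
  secondEqThird i i≤m = _ , _ , _ , _ , huffSeq-fibs m i i≤m , refl

fibs-cost : ∀ k {T} → Elongated T → HuffmanTree (1 ∷ fibsFrom 1 k) T → E T ≤ fibCost k
fibs-cost k {T} e h =
  spine-cost-tight (huffman-spine (cong suc (length-fibsFrom 1 k)) (fibs-positive k) e h)
    (≤-reflexive (begin
      weight T                                        ≡⟨ huffRun-additive weight (λ _ _ → refl) h ⟩
      sum (map weight (map leaf (1 ∷ fibsFrom 1 k)))  ≡⟨ sum-weight-leaves (1 ∷ fibsFrom 1 k) ⟩
      F 2 + sum (fibsFrom 1 k)                        ≡⟨ sum-fibsFrom 1 k ⟩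
      F (2 + k)                                       ∎))
  where open ≡-Reasoning

corollary2 : (n : ℕ) → 3 ≤ n →
    M n (n ∸ 3) (fibSeq n)
    × ((P : List ℕ) → M n (n ∸ 3) P →
       (T₀ T : Tree) → Elongated T₀ → HuffmanTree (fibSeq n) T₀ →
       Elongated T → HuffmanTree P T → E T₀ ≤ E T)
corollary2 (suc (suc (suc m))) (s≤s (s≤s (s≤s z≤n))) =
  subst (M (3 + m) m) (sym fibSeq≡) (fibs-M m) ,
  λ P (((len , _ , pos) , _) , _) T₀ T e₀ h₀ e h → begin
    E T₀            ≤⟨ fibs-cost (2 + m) e₀ (subst (λ Q → HuffmanTree Q T₀) fibSeq≡ h₀) ⟩
    fibCost (2 + m) ≤⟨ spine-cost-lower (huffman-spine len pos e h) ⟩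
    E T             ∎
  where
  open ≤-Reasoning
  fibSeq≡ : fibSeq (3 + m) ≡ 1 ∷ fibsFrom 1 (2 + m)
  fibSeq≡ = fibSeq-fibsFrom (2 + m)
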